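{- For all integers $m\geqslant l\geqslant 1$ and every positive integer $n$, $$\kappa_l(n,m)\geqslant\max_{2\leqslant i\leqslant m}\left\{\kappa_{\,l-\binom{m-2}{i-2}}\left(n-\binom{m}{i},\,m\right)+\binom{m-1}{i-1}\right\}.$$
   Context: For an integer $n$, $[n]=\{1,\ldots,n\}$ (empty if $n\leqslant 0$). A family $\mathcal{F}$ of subsets of $[n]$ is an $m$-family if it has $m$ members (required to be pairwise distinct subsets); it is $k$-uniform if every member has size $k$; for a set $L$ of nonnegative integers it is $L$-intersecting if $|F\cap F'|\in L$ for every two distinct members $F,F'$. For an integer $l\geqslant 0$, $\kappa_l(n,m)$ denotes the maximum $k$ such that there exists a $k$-uniform $\{l\}$-intersecting $m$-family of subsets of $[n]$, with $\kappa_l(n,m)=-\infty$ if no such family exists; by convention $\kappa_l(n,m)=-\infty$ when $l$ is negative. Here $-\infty+c=-\infty$. -}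

module Defs where

open import Data.Nat using (ℕ; _≤_; _+_; _∸_)
open import Data.Nat.Combinatorics using (_C_)
open import Data.Fin using (Fin)
open import Data.Fin.Subset using (Subset; ∣_∣; _∩_)
open import Data.Product using (Σ; _×_)
open import Relation.Binary.PropositionalEquality using (_≡_; _≢_)

Family : ℕ → ℕ → Set
Family n m = Fin m → Subset n

-- members pairwise distinct (so it really has m members)
Distinct : ∀ {n m} → Family n m → Set
Distinct F = ∀ i j → i ≢ j → F i ≢ F j

Uniform : ∀ {n m} → ℕ → Family n m → Set
Uniform k F = ∀ i → ∣ F i ∣ ≡ k

Intersecting : ∀ {n m} → ℕ → Family n m → Set
Intersecting l F = ∀ i j → i ≢ j → ∣ F i ∩ F j ∣ ≡ l

-- Achievable l n m k : there is a k-uniform {l}-intersecting m-family of subsets of [n].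
-- κ_l(n,m) is the maximum k with Achievable l n m k (or -∞ if there is none).
Achievable : ℕ → ℕ → ℕ → ℕ → Set
Achievable l n m k = Σ (Family n m) λ F → Distinct F × Uniform k F × Intersecting l F

-- "κ_l(n,m) ≥ k" for a natural k (κ is a maximum, so this means some k' ≥ k is achievable)
KappaAtLeast : ℕ → ℕ → ℕ → ℕ → Set
KappaAtLeast l n m k = Σ ℕ λ k' → k ≤ k' × Achievable l n m k'

module Submission where

-- For 2 ≤ i ≤ m, the star family
-- S_j = { T ⊆ [m] : |T| = i, j ∈ T }   (j ∈ [m]),
-- viewed as subsets of the ground set of all i-subsets of [m] (size C(m,i)),
-- is (C(m-1,i-1))-uniform and {C(m-2,i-2)}-intersecting.  Juxtaposing a
-- k-uniform {l - C(m-2,i-2)}-intersecting m-family on [n - C(m,i)] with the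
-- star family (member by member, on disjoint ground sets) yields a
-- (k + C(m-1,i-1))-uniform {l}-intersecting m-family on [n].
--
-- Finally, since two distinct members cannot live on an empty
-- ground set, the hypothesis forces C(m,i) ≤ n, and the theorem follows.

open import Defs
open import Data.Nat using (ℕ; _≤_; _+_; _∸_)
open import Data.Nat.Combinatorics using (_C_)
open import Data.Nat using (zero; suc; s≤s; z≤n)
open import Data.Nat.Properties using (+-comm; m∸n+n≡m; m∸n≢0⇒n<m; <⇒≤; ≤-refl)
open import Data.Nat.Combinatorics using (nCk+nC[k+1]≡[n+1]C[k+1])
open import Data.Bool using (true; false; _∧_)
open import Data.Vec using ([]; _∷_; _++_)
open import Data.Vec.Properties using (++-injectiveˡ; zipWith-++)
open import Data.Fin using (Fin) renaming (zero to fz; suc to fs)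
open import Data.Fin.Subset using (Subset; ∣_∣; _∩_; ⊥; ⊤)
open import Data.Fin.Subset.Properties using (∣⊥∣≡0; ∣⊤∣≡n; ∩-comm; ∩-zeroˡ; ∩-identityˡ)
open import Data.Product using (_,_)
open import Data.Empty using () renaming (⊥-elim to absurd)
open import Relation.Binary.PropositionalEquality
  using (_≡_; _≢_; refl; sym; trans; cong; cong₂; subst₂; module ≡-Reasoning)

∣++∣ : ∀ {a b} (p : Subset a) (q : Subset b) → ∣ p ++ q ∣ ≡ ∣ p ∣ + ∣ q ∣
∣++∣ []          q = refl
∣++∣ (true ∷ p)  q = cong suc (∣++∣ p q)
∣++∣ (false ∷ p) q = ∣++∣ p q

∩-++ : ∀ {a b} (p p′ : Subset a) (q q′ : Subset b) →
       (p ++ q) ∩ (p′ ++ q′) ≡ (p ∩ p′) ++ (q ∩ q′)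
∩-++ p p′ q q′ = zipWith-++ _∧_ p q p′ q′

∣∩-++∣ : ∀ {a b} (p p′ : Subset a) (q q′ : Subset b) →
         ∣ (p ++ q) ∩ (p′ ++ q′) ∣ ≡ ∣ p ∩ p′ ∣ + ∣ q ∩ q′ ∣
∣∩-++∣ p p′ q q′ = trans (cong ∣_∣ (∩-++ p p′ q q′)) (∣++∣ (p ∩ p′) (q ∩ q′))

record Design (N m a c : ℕ) : Set where
  field
    members      : Family N m
    uniform      : Uniform a members
    intersecting : Intersecting c members

retype : ∀ {N N′ m a a′ c c′} → N ≡ N′ → a ≡ a′ → c ≡ c′ → Design N m a c → Design N′ m a′ c′
retype refl refl refl design = design

juxtapose : ∀ {l c n N m k a} → Design N m a c →
            Achievable l n m k → Achievable (l + c) (n + N) m (k + a)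
juxtapose design (F , distinctF , uniformF , meetF) =
  H , distinctH , uniformH , meetH
  where
  open Design design renaming (members to G; uniform to uniformG; intersecting to meetG)

  H : Family _ _
  H j = F j ++ G j

  distinctH : Distinct H
  distinctH i j i≢j Hi≡Hj = distinctF i j i≢j (++-injectiveˡ (F i) (F j) Hi≡Hj)

  uniformH : Uniform _ H
  uniformH j = trans (∣++∣ (F j) (G j)) (cong₂ _+_ (uniformF j) (uniformG j))

  meetH : Intersecting _ H
  meetH i j i≢j =
    trans (∣∩-++∣ (F i) (F j) (G i) (G j)) (cong₂ _+_ (meetF i j i≢j) (meetG i j i≢j))

-- Binomial coefficients by Pascal's rule; the recursion is the one along
-- which the star family is built.
binom : ℕ → ℕ → ℕ
binom _       zero    = 1
binom zero    (suc i) = 0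
binom (suc m) (suc i) = binom m (suc i) + binom m i

binom≡C : ∀ m i → binom m i ≡ m C i
binom≡C m       zero    = refl
binom≡C zero    (suc i) = refl
binom≡C (suc m) (suc i) = begin
  binom m (suc i) + binom m i  ≡⟨ cong₂ _+_ (binom≡C m (suc i)) (binom≡C m i) ⟩
  m C suc i + m C i            ≡⟨ +-comm (m C suc i) (m C i) ⟩
  m C i + m C suc i            ≡⟨ nCk+nC[k+1]≡[n+1]C[k+1] m i ⟩
  suc m C suc i                ∎
  where open ≡-Reasoning

-- Shifted binomial coefficient: binomShift d m i = C(m, i - d), zero if i < d.
-- Members of the star family have C(m-1, i-1) elements and pairwise meet in
-- C(m-2, i-2) elements, including the degenerate small values of i.
binomShift : ℕ → ℕ → ℕ → ℕ
binomShift zero    m i       = binom m i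
binomShift (suc d) m zero    = 0
binomShift (suc d) m (suc i) = binomShift d m i

binomShift-pascal : ∀ d m i →
  binomShift d (suc m) (suc i) ≡ binomShift d m (suc i) + binomShift d m i
binomShift-pascal zero          m i       = refl
binomShift-pascal (suc zero)    m zero    = refl
binomShift-pascal (suc (suc d)) m zero    = refl
binomShift-pascal (suc d)       m (suc i) = binomShift-pascal d m i

-- The star family: star m i j ⊆ {i-subsets of [m]} lists the i-subsets
-- containing j.  The ground set of (i+1)-subsets of [m+1] is split as
-- those avoiding the first point followed by those containing it.
star : (m i : ℕ) → Fin m → Subset (binom m i)
star m       zero    j      = ⊥
star zero    (suc i) ()
star (suc m) (suc i) fz     = ⊥ {binom m (suc i)} ++ ⊤
star (suc m) (suc i) (fs j) = star m (suc i) j ++ star m i j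

star-size : ∀ m i (j : Fin (suc m)) → ∣ star (suc m) i j ∣ ≡ binomShift 1 m i
star-size m       zero    j      = ∣⊥∣≡0 1
star-size m       (suc i) fz     =
  trans (∣++∣ (⊥ {binom m (suc i)}) ⊤) (cong₂ _+_ (∣⊥∣≡0 (binom m (suc i))) (∣⊤∣≡n (binom m i)))
star-size (suc m) (suc i) (fs j) = begin
  ∣ star (suc m) (suc i) j ++ star (suc m) i j ∣
    ≡⟨ ∣++∣ (star (suc m) (suc i) j) (star (suc m) i j) ⟩
  ∣ star (suc m) (suc i) j ∣ + ∣ star (suc m) i j ∣
    ≡⟨ cong₂ _+_ (star-size m (suc i) j) (star-size m i j) ⟩
  binomShift 1 m (suc i) + binomShift 1 m i
    ≡⟨ sym (binomShift-pascal 1 m i) ⟩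
  binomShift 1 (suc m) (suc i) ∎
  where open ≡-Reasoning

-- The star of the first point meets the star of another point j exactly in the
-- second block (sets containing the first point), where it is a star of j on
-- one point fewer; so the meet has C(m, (i+1)-2) elements.
star-meet-first : ∀ m i (j : Fin (suc m)) →
  ∣ star (suc (suc m)) (suc i) fz ∩ star (suc (suc m)) (suc i) (fs j) ∣ ≡ binomShift 2 m (suc i)
star-meet-first m i j = begin
  ∣ (⊥ {binom (suc m) (suc i)} ++ ⊤) ∩ (star (suc m) (suc i) j ++ star (suc m) i j) ∣
    ≡⟨ ∣∩-++∣ ⊥ (star (suc m) (suc i) j) ⊤ (star (suc m) i j) ⟩
  ∣ ⊥ ∩ star (suc m) (suc i) j ∣ + ∣ ⊤ ∩ star (suc m) i j ∣
    ≡⟨ cong₂ (λ p q → ∣ p ∣ + ∣ q ∣) (∩-zeroˡ (star (suc m) (suc i) j))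
                                     (∩-identityˡ (star (suc m) i j)) ⟩
  ∣ ⊥ {binom (suc m) (suc i)} ∣ + ∣ star (suc m) i j ∣
    ≡⟨ cong₂ _+_ (∣⊥∣≡0 (binom (suc m) (suc i))) (star-size m i j) ⟩
  binomShift 2 m (suc i) ∎
  where open ≡-Reasoning

star-meet : ∀ m i (j j′ : Fin (suc (suc m))) → j ≢ j′ →
  ∣ star (suc (suc m)) i j ∩ star (suc (suc m)) i j′ ∣ ≡ binomShift 2 m i
star-meet m       zero    j      j′      _    = refl
star-meet m       (suc i) fz     fz      j≢j′ = absurd (j≢j′ refl)
star-meet m       (suc i) fz     (fs j′) _    = star-meet-first m i j′
star-meet m       (suc i) (fs j) fz      _    =
  trans (cong ∣_∣ (∩-comm (star (suc (suc m)) (suc i) (fs j)) (star (suc (suc m)) (suc i) fz)))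
        (star-meet-first m i j)
star-meet zero    (suc i) (fs fz) (fs fz) j≢j′ = absurd (j≢j′ refl)
star-meet (suc m) (suc i) (fs j) (fs j′) j≢j′ = begin
  ∣ (star (2 + m) (suc i) j ++ star (2 + m) i j) ∩ (star (2 + m) (suc i) j′ ++ star (2 + m) i j′) ∣
    ≡⟨ ∣∩-++∣ (star (2 + m) (suc i) j) (star (2 + m) (suc i) j′) (star (2 + m) i j) (star (2 + m) i j′) ⟩
  ∣ star (2 + m) (suc i) j ∩ star (2 + m) (suc i) j′ ∣ + ∣ star (2 + m) i j ∩ star (2 + m) i j′ ∣
    ≡⟨ cong₂ _+_ (star-meet m (suc i) j j′ tails-distinct) (star-meet m i j j′ tails-distinct) ⟩
  binomShift 2 m (suc i) + binomShift 2 m i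
    ≡⟨ sym (binomShift-pascal 2 m i) ⟩
  binomShift 2 (suc m) (suc i) ∎
  where
  open ≡-Reasoning
  tails-distinct : j ≢ j′
  tails-distinct j≡j′ = j≢j′ (cong fs j≡j′)

starDesign : ∀ m i → Design ((2 + m) C (2 + i)) (2 + m) ((1 + m) C (1 + i)) (m C i)
starDesign m i =
  retype (binom≡C (2 + m) (2 + i)) (binom≡C (1 + m) (1 + i)) (binom≡C m i)
         (record { members      = star (2 + m) (2 + i)
                 ; uniform      = star-size (1 + m) (2 + i)
                 ; intersecting = star-meet m (2 + i) })

nonempty-ground : ∀ {l n m k} → Achievable l n (suc (suc m)) k → n ≢ 0
nonempty-ground (F , distinctF , _) refl = distinctF fz (fs fz) (λ ()) (empty (F fz) (F (fs fz)))
  where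
  empty : (p q : Subset 0) → p ≡ q
  empty [] [] = refl

-- Main theorem: with c = C(m-2, i-2) and N = C(m,i), juxtaposing the star
-- design with the given family gives a (k + C(m-1,i-1))-uniform
-- {(l ∸ c) + c}-intersecting family on [(n ∸ N) + N]; as c ≤ l and N ≤ n these
-- are l and n.
theorem2p5 : (n m l : ℕ) → 1 ≤ l → l ≤ m → 1 ≤ n →
    (i : ℕ) → 2 ≤ i → i ≤ m →
    (m ∸ 2) C (i ∸ 2) ≤ l →
    (k : ℕ) → Achievable (l ∸ ((m ∸ 2) C (i ∸ 2))) (n ∸ (m C i)) m k →
    KappaAtLeast l n m (k + ((m ∸ 1) C (i ∸ 1)))
theorem2p5 n (suc (suc m)) l _ _ _ (suc (suc i)) (s≤s (s≤s z≤n)) (s≤s (s≤s _)) meet≤l k achievable =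
  k + _ , ≤-refl , subst₂ (λ l′ n′ → Achievable l′ n′ (2 + m) _)
                          (m∸n+n≡m meet≤l) (m∸n+n≡m starGround≤n)
                          (juxtapose (starDesign m i) achievable)
  where
  starGround≤n : (2 + m) C (2 + i) ≤ n
  starGround≤n = <⇒≤ (m∸n≢0⇒n<m (nonempty-ground achievable))
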